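{- Let $C, L, k \geq 1$ be integers. If $C=1$ or $L=1$ or $k\geq C$, then $\gamma_{P,k}(WKP_{(C,L)})=1$.
   Context: For a graph $G$, $S\subseteq V(G)$ and an integer $k\ge 0$, define $\mathcal{P}^0_{G,k}(S)=N_G[S]$ (closed neighbourhood of $S$) and $\mathcal{P}^{i+1}_{G,k}(S)=\bigcup\{N_G[v] : v\in \mathcal{P}^i_{G,k}(S),\ |N_G[v]\setminus \mathcal{P}^i_{G,k}(S)|\le k\}$. These sets increase and stabilize at a set $\mathcal{P}^\infty_{G,k}(S)$. A $k$-power dominating set ($k$-PDS) is a set $S$ with $\mathcal{P}^\infty_{G,k}(S)=V(G)$, and $\gamma_{P,k}(G)$ is the minimum cardinality of a $k$-PDS of $G$. Let $[C]_0=\{0,\dots,C-1\}$. The WK-Pyramid network $WKP_{(C,L)}$ has vertex set $\{(r,(a_r a_{r-1}\cdots a_1)) : r\in\{1,\dots,L\},\ a_i\in[C]_0\}\cup\{(0,(1))\}$; a vertex $(r,(a_r\cdots a_1))$ is said to be at level $r$. The vertex $(0,(1))$ is adjacent to every vertex at level $1$. A vertex $(r,(a_r\cdots a_1))$ with $r>0$ is adjacent to: (1) the vertices $(r,(a_r\cdots a_2 b))$ with $b\in[C]_0$, $b\ne a_1$; (2) the vertex $(r,(a_r\cdots a_{j+1}a_{j-1}(a_j)^{j-1}))$ if there is a $j$ with $2\le j\le r$, $a_{j-1}=a_{j-2}=\cdots=a_1$ and $a_j\ne a_{j-1}$, where $(a_j)^{j-1}$ denotes $a_j$ repeated $j-1$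 times; (3) the vertices $(r+1,(a_r\cdots a_1 b))$ for $b\in[C]_0$ (when $r<L$); (4) the vertex $(r-1,(a_r\cdots a_2))$ (for $r=1$ this is $(0,(1))$). -}

module Defs where

open import Data.Nat using (ℕ; zero; suc; _≤_)
open import Data.Fin using (Fin)
open import Data.List using (List; []; _∷_; length; replicate; _++_)
open import Data.List.Membership.Propositional using (_∈_)
open import Data.List.Relation.Unary.Unique.Propositional using (Unique)
open import Data.Product using (Σ; _×_)
open import Data.Sum using (_⊎_)
open import Relation.Binary.PropositionalEquality using (_≡_; _≢_)
open import Relation.Nullary using (¬_)

module PowerDomination {V : Set} (Adj : V → V → Set) where

  N[_] : V → V → Set
  N[ v ] u = (u ≡ v) ⊎ Adj v u

  AtMost : ℕ → (V → Set) → Set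
  AtMost k A = Σ (List V) λ xs → (length xs ≤ k) × (∀ u → A u → u ∈ xs)

  P : ℕ → ℕ → List V → V → Set
  P k zero    S u = Σ V λ s → (s ∈ S) × N[ s ] u
  P k (suc i) S u =
    Σ V λ v → P k i S v
            × AtMost k (λ w → N[ v ] w × ¬ P k i S w)
            × N[ v ] u

  P∞ : ℕ → List V → V → Set
  P∞ k S u = Σ ℕ λ i → P k i S u

  IsPDS : ℕ → List V → Set
  IsPDS k S = ∀ u → P∞ k S u

  -- γ_{P,k}(G) = n : sets are duplicate-free lists, cardinality = length
  PowerDomNumberIs : ℕ → ℕ → Set
  PowerDomNumberIs k n =
    (Σ (List V) λ S → Unique S × (length S ≡ n) × IsPDS k S)
    × (∀ S → Unique S → IsPDS k S → n ≤ length S)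

-- The WK-Pyramid network WKP_(C,L).
-- A vertex (r,(a_r … a_1)) is stored as  node ds  where ds is the list
-- of digits in REVERSED order: ds = a_1 ∷ a_2 ∷ … ∷ a_r ∷ [], so r = length ds.

data WKV (C L : ℕ) : Set where
  apex : WKV C L                                           -- (0,(1))
  node : (ds : List (Fin C)) → 1 ≤ length ds → length ds ≤ L → WKV C L

data Arc {C L : ℕ} : WKV C L → WKV C L → Set where
  apex-arc : ∀ a {p q} → Arc apex (node (a ∷ []) p q)
  sib : ∀ a b ds {p q p' q'} → b ≢ a →
        Arc (node (a ∷ ds) p q) (node (b ∷ ds) p' q')
  -- (2): with j = m+1, a_1 = … = a_{j-1} = x, a_j = y ≠ x
  jump : ∀ m x y rest {p q p' q'} → 1 ≤ m → y ≢ x →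
         Arc (node (replicate m x ++ (y ∷ rest)) p q)
             (node (replicate m y ++ (x ∷ rest)) p' q')
  -- (3): children (r < L is enforced by q')
  child : ∀ b ds {p q p' q'} → Arc (node ds p q) (node (b ∷ ds) p' q')
  parent : ∀ a ds {p q p' q'} → Arc (node (a ∷ ds) p q) (node ds p' q')
  parent-apex : ∀ a {p q} → Arc (node (a ∷ []) p q) apex

WKPAdj : (C L : ℕ) → WKV C L → WKV C L → Set
WKPAdj C L u v = Arc u v ⊎ Arc v u

γP≡ : (C L k n : ℕ) → Set
γP≡ C L k n = PowerDomination.PowerDomNumberIs (WKPAdj C L) k n

-- Take the apex (0,(1)) as the single power dominating vertex. Every neighbour of a
-- vertex v is either at level at most that of v or one of the at most C children
-- of v, so once all vertices up to level i are observed, each of them has at most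
-- C ≤ k unobserved neighbours and propagates to level i + 1; after step i every
-- vertex of level ≤ i is observed. If L = 1 no propagation is needed: N[apex] is
-- already everything. If C = 1 then C ≤ k.
module Submission where

open import Defs
open import Data.Nat using (ℕ; _≤_)
open import Data.Sum using (_⊎_)
open import Relation.Binary.PropositionalEquality using (_≡_)

open import Data.Nat using (zero; suc; _<_; z≤n; s≤s; _≤?_)
open import Data.Nat.Properties
  using (≤-irrelevant; ≤-refl; ≤-trans; ≤-reflexive; ≤-pred; n≤1+n; n<1+n; n≤0⇒n≡0)
open import Data.Fin using (Fin)
open import Data.List using (List; []; _∷_; length; replicate; _++_; map; allFin)
open import Data.List.Properties using (length-map; length-tabulate)
open import Data.List.Membership.Propositional using (_∈_)
open import Data.List.Membership.Propositional.Properties using (∈-map⁺; ∈-allFin)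
open import Data.List.Relation.Unary.Any using (here)
open import Data.List.Relation.Unary.All using ([])
open import Data.List.Relation.Unary.AllPairs using ([]; _∷_)
open import Data.List.Relation.Unary.Unique.Propositional using (Unique)
open import Data.Product using (Σ; _×_; _,_)
open import Data.Sum using (inj₁; inj₂)
open import Data.Empty using (⊥-elim)
open import Relation.Nullary using (yes; no; ¬_)
open import Relation.Binary.PropositionalEquality using (refl; cong; cong₂; sym; trans; subst)

module _ {V : Set} (Adj : V → V → Set) where
  open PowerDomination Adj

  P-[] : ∀ {k} i {u} → ¬ P k i [] u
  P-[] zero    (_ , () , _)
  P-[] (suc i) (v , v∈P , _) = P-[] i v∈P

  singleton-PDS⇒γ≡1 : ∀ {k} v → IsPDS k (v ∷ []) → PowerDomNumberIs k 1
  singleton-PDS⇒γ≡1 {k} v pds = (v ∷ [] , [] ∷ [] , refl , pds) , nonempty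
    where
    nonempty : ∀ S → Unique S → IsPDS k S → 1 ≤ length S
    nonempty []      _ pds′ with pds′ v
    ... | i , v∈P = ⊥-elim (P-[] i v∈P)
    nonempty (_ ∷ _) _ _ = s≤s z≤n

  module LevelledPropagation
    {k : ℕ} {S : List V}
    (level : V → ℕ) (children : V → List V)
    (few-children : ∀ v → length (children v) ≤ k)
    (N⇒lower-or-child : ∀ {v w} → N[ v ] w → level w ≤ level v ⊎ w ∈ children v)
    (level0⇒∈S : ∀ u → level u ≡ 0 → u ∈ S)
    (level0-or-lower-neighbour : ∀ u → level u ≡ 0 ⊎ Σ V λ v → level v < level u × N[ v ] u)
    where

    level≤⇒P : ∀ i u → level u ≤ i → P k i S u
    frontier : ∀ i w → level w ≤ i → AtMost k (λ x → N[ w ] x × ¬ P k i S x)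

    level≤⇒P zero    u lu = u , level0⇒∈S u (n≤0⇒n≡0 lu) , inj₁ refl
    level≤⇒P (suc i) u lu with level0-or-lower-neighbour u
    ... | inj₁ lu≡0 = u , level≤⇒P i u lu≤i , frontier i u lu≤i , inj₁ refl
      where lu≤i = subst (_≤ i) (sym lu≡0) z≤n
    ... | inj₂ (v , v<u , v~u) = v , level≤⇒P i v lv≤i , frontier i v lv≤i , v~u
      where lv≤i = ≤-pred (≤-trans v<u lu)

    frontier i w lw = children w , few-children w , unobserved⇒child
      where
      unobserved⇒child : ∀ x → N[ w ] x × ¬ P k i S x → x ∈ children w
      unobserved⇒child x (w~x , x∉P) with N⇒lower-or-child w~x
      ... | inj₁ lx = ⊥-elim (x∉P (level≤⇒P i x (≤-trans lx lw)))
      ... | inj₂ x∈ = x∈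

    isPDS : IsPDS k S
    isPDS u = level u , level≤⇒P (level u) u ≤-refl

module WKPyramid (C L : ℕ) where
  open PowerDomination (WKPAdj C L)

  level : WKV C L → ℕ
  level apex          = 0
  level (node ds _ _) = length ds

  node-irrelevant : ∀ {ds} {p p′ : 1 ≤ length ds} {q q′ : length ds ≤ L} →
                    node {C} {L} ds p q ≡ node ds p′ q′
  node-irrelevant {p = p} {p′} {q} {q′} = cong₂ (node _) (≤-irrelevant p p′) (≤-irrelevant q q′)

  childrenOf : List (Fin C) → List (WKV C L)
  childrenOf ds with suc (length ds) ≤? L
  ... | yes q = map (λ a → node (a ∷ ds) (s≤s z≤n) q) (allFin C)
  ... | no _  = []

  length-childrenOf : ∀ ds → length (childrenOf ds) ≤ C
  length-childrenOf ds with suc (length ds) ≤? L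
  ... | yes _ = ≤-reflexive (trans (length-map _ (allFin C)) (length-tabulate _))
  ... | no _  = z≤n

  ∈-childrenOf : ∀ b ds {p q} → node (b ∷ ds) p q ∈ childrenOf ds
  ∈-childrenOf b ds {q = q} with suc (length ds) ≤? L
  ... | yes q′ = subst (_∈ map extend (allFin C)) node-irrelevant (∈-map⁺ extend (∈-allFin b))
    where extend : Fin C → WKV C L
          extend a = node (a ∷ ds) (s≤s z≤n) q′
  ... | no q≰  = ⊥-elim (q≰ q)

  children : WKV C L → List (WKV C L)
  children apex          = childrenOf []
  children (node ds _ _) = childrenOf ds

  length-children : ∀ v → length (children v) ≤ C
  length-children apex          = length-childrenOf []
  length-children (node ds _ _) = length-childrenOf ds

  length-jump : ∀ m (x y : Fin C) rest →
                length (replicate m x ++ y ∷ rest) ≡ length (replicate m y ++ x ∷ rest)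
  length-jump zero    x y rest = refl
  length-jump (suc m) x y rest = cong suc (length-jump m x y rest)

  Arc⇒level-or-child : ∀ {v w} → Arc v w → level w ≤ level v ⊎ w ∈ children v
  Arc⇒level-or-child (apex-arc a)          = inj₂ (∈-childrenOf a [])
  Arc⇒level-or-child (sib a b ds _)        = inj₁ ≤-refl
  Arc⇒level-or-child (jump m x y rest _ _) = inj₁ (≤-reflexive (sym (length-jump m x y rest)))
  Arc⇒level-or-child (child b ds)          = inj₂ (∈-childrenOf b ds)
  Arc⇒level-or-child (parent a ds)         = inj₁ (n≤1+n _)
  Arc⇒level-or-child (parent-apex a)       = inj₁ z≤n

  Arc⁻¹⇒level-or-child : ∀ {v w} → Arc w v → level w ≤ level v ⊎ w ∈ children v
  Arc⁻¹⇒level-or-child (apex-arc a)          = inj₁ z≤n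
  Arc⁻¹⇒level-or-child (sib a b ds _)        = inj₁ ≤-refl
  Arc⁻¹⇒level-or-child (jump m x y rest _ _) = inj₁ (≤-reflexive (length-jump m x y rest))
  Arc⁻¹⇒level-or-child (child b ds)          = inj₁ (n≤1+n _)
  Arc⁻¹⇒level-or-child (parent a ds)         = inj₂ (∈-childrenOf a ds)
  Arc⁻¹⇒level-or-child (parent-apex a)       = inj₂ (∈-childrenOf a [])

  N⇒level-or-child : ∀ {v w} → N[ v ] w → level w ≤ level v ⊎ w ∈ children v
  N⇒level-or-child (inj₁ refl)       = inj₁ ≤-refl
  N⇒level-or-child (inj₂ (inj₁ arc)) = Arc⇒level-or-child arc
  N⇒level-or-child (inj₂ (inj₂ arc)) = Arc⁻¹⇒level-or-child arc

  level0⇒apex : ∀ u → level u ≡ 0 → u ∈ apex ∷ []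
  level0⇒apex apex _ = here refl
  level0⇒apex (node (_ ∷ _) _ _) ()

  apex-or-parent : ∀ u → level u ≡ 0 ⊎ Σ (WKV C L) λ v → level v < level u × N[ v ] u
  apex-or-parent apex                = inj₁ refl
  apex-or-parent (node (a ∷ []) _ _) = inj₂ (apex , s≤s z≤n , inj₂ (inj₁ (apex-arc a)))
  apex-or-parent (node (a ∷ b ∷ ds) _ (s≤s q)) =
    inj₂ (node (b ∷ ds) (s≤s z≤n) (≤-trans (n≤1+n _) (s≤s q)) , n<1+n _ , inj₂ (inj₂ (parent a (b ∷ ds))))

  apex-PDS-when-few-children : ∀ {k} → C ≤ k → IsPDS k (apex ∷ [])
  apex-PDS-when-few-children C≤k = LevelledPropagation.isPDS (WKPAdj C L) level children
    (λ v → ≤-trans (length-children v) C≤k) N⇒level-or-child level0⇒apex apex-or-parent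

  apex-dominates-level≤1 : ∀ {k} u → level u ≤ 1 → P k 0 (apex ∷ []) u
  apex-dominates-level≤1 apex                  _ = apex , here refl , inj₁ refl
  apex-dominates-level≤1 (node (a ∷ []) _ _)   _ = apex , here refl , inj₂ (inj₁ (apex-arc a))
  apex-dominates-level≤1 (node (_ ∷ _ ∷ _) _ _) (s≤s ())

  level≤L : ∀ u → level u ≤ L
  level≤L apex         = z≤n
  level≤L (node _ _ q) = q

  apex-PDS-when-L≤1 : ∀ {k} → L ≤ 1 → IsPDS k (apex ∷ [])
  apex-PDS-when-L≤1 {k} L≤1 u = 0 , apex-dominates-level≤1 {k} u (≤-trans (level≤L u) L≤1)

open WKPyramid

mainTheorem1 : (C L k : ℕ) → 1 ≤ C → 1 ≤ L → 1 ≤ k →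
    (C ≡ 1) ⊎ (L ≡ 1) ⊎ (C ≤ k) → γP≡ C L k 1
mainTheorem1 C L k _ _ 1≤k cases = singleton-PDS⇒γ≡1 (WKPAdj C L) apex (apex-PDS cases)
  where
  apex-PDS : (C ≡ 1) ⊎ (L ≡ 1) ⊎ (C ≤ k) → PowerDomination.IsPDS (WKPAdj C L) k (apex ∷ [])
  apex-PDS (inj₁ refl)        = apex-PDS-when-few-children 1 L 1≤k
  apex-PDS (inj₂ (inj₁ refl)) = apex-PDS-when-L≤1 C 1 ≤-refl
  apex-PDS (inj₂ (inj₂ C≤k))  = apex-PDS-when-few-children C L C≤k
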